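{- Let $A$ be an alternating sign matrix of order $n\ge 2$. Then there is an $n\times n$ permutation matrix $P$ such that $A+P$ is a $(0,1,-1)$-matrix; in particular $A$ has an ASM-mate, which may be chosen to be a permutation matrix.
   Context: An $n\times n$ alternating sign matrix (ASM) is a $(0,\pm1)$-matrix whose rows and columns each have nonzeros alternating in sign beginning and ending with $+1$. An ASM $B$ is an ASM-mate of the ASM $A$ if $A+B$ is a $(0,1,-1)$-matrix. -}

module Defs where

open import Data.Nat using (ℕ)
open import Data.Integer using (ℤ; +_; -[1+_]; _+_; 0ℤ; 1ℤ)
open import Data.Fin using (Fin)
open import Data.Fin.Permutation using (Permutation′; _⟨$⟩ʳ_)
open import Data.Fin.Properties using () renaming (_≟_ to _≟ᶠ_)
open import Data.List using (List; []; _∷_; filter)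
open import Data.Vec.Functional using (toList)
open import Data.Sum using (_⊎_)
open import Relation.Nullary using (¬_; ¬?; does)
open import Data.Bool using (true; false)
open import Data.Product using (∃; _×_)
open import Relation.Unary using (∁)
open import Relation.Binary.PropositionalEquality using (_≡_)
import Data.Integer.Properties as ℤP

Matrix : ℕ → Set
Matrix n = Fin n → Fin n → ℤ

Is01m1 : ℤ → Set
Is01m1 x = (x ≡ 0ℤ) ⊎ (x ≡ 1ℤ) ⊎ (x ≡ -[1+ 0 ])

Is01m1Matrix : {n : ℕ} → Matrix n → Set
Is01m1Matrix {n} M = ∀ (i j : Fin n) → Is01m1 (M i j)

data AltSigns : List ℤ → Set where
  alt-one  : AltSigns (1ℤ ∷ [])
  alt-step : ∀ {xs} → AltSigns xs → AltSigns (1ℤ ∷ -[1+ 0 ] ∷ xs)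

nonzeros : List ℤ → List ℤ
nonzeros = filter {P = ∁ (_≡ 0ℤ)} (λ x → ¬? (x ℤP.≟ 0ℤ))

row : {n : ℕ} → Matrix n → Fin n → List ℤ
row M i = toList (λ j → M i j)

col : {n : ℕ} → Matrix n → Fin n → List ℤ
col M j = toList (λ i → M i j)

record IsASM {n : ℕ} (A : Matrix n) : Set where
  field
    entries : Is01m1Matrix A
    rows    : ∀ i → AltSigns (nonzeros (row A i))
    cols    : ∀ j → AltSigns (nonzeros (col A j))

permMatrix : {n : ℕ} → Permutation′ n → Matrix n
permMatrix σ i j with does (j ≟ᶠ (σ ⟨$⟩ʳ i))
... | true  = 1ℤ
... | false = 0ℤ

IsPermutationMatrix : {n : ℕ} → Matrix n → Set
IsPermutationMatrix {n} P = ∃ λ (σ : Permutation′ n) → ∀ i j → P i j ≡ permMatrix σ i j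

_⊕_ : {n : ℕ} → Matrix n → Matrix n → Matrix n
(A ⊕ B) i j = A i j + B i j

IsASMMate : {n : ℕ} → Matrix n → Matrix n → Set
IsASMMate A B = IsASM B × Is01m1Matrix (A ⊕ B)

module Submission where

-- Let c r j be the sum of the first r entries of column j of A.
-- Because the nonzeros of a column alternate +1, -1, ..., +1, every such
-- prefix sum is 0 or 1, and because every row of A sums to 1 we have
-- ∑_j c r j = r: after r rows exactly r columns are "open".  Choosing for
-- row t + 1 an open column of c (t + 1) is safe, since
-- c (t + 2) j = c (t + 1) j + A (t+1) j ≤ 1 forces A (t+1) j ≠ 1.  The
-- open sets have sizes 1, 2, ..., n - 1, so a greedy choice gives distinct
-- columns g t for the rows 1, ..., n - 1.  Row 0 gets the remaining
-- column; it cannot carry the single 1 of row 0, which is the only open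
-- column of c 1 and hence was already taken by row 1 (here n ≥ 2 is used).
-- Thus there is a permutation σ with A i (σ i) ≠ 1 for all i, and then
-- A + P_σ is a (0,1,-1)-matrix and P_σ is an ASM.

open import Defs
open import Data.Nat using (ℕ; _≥_; zero; suc; _<_; _≤_; z≤n; s≤s)
import Data.Nat.Properties as ℕP
open import Data.Integer using (ℤ; +_; -[1+_]; _+_; 0ℤ; 1ℤ)
import Data.Integer.Properties as ℤP
open import Data.Fin using (Fin; zero; suc; toℕ; fromℕ; inject₁; punchIn; punchOut)
open import Data.Fin.Properties
  using (any?; all?; ¬∀⟶∃¬; <⇒notInjective; punchIn-punchOut; suc-injective;
         toℕ-inject₁; toℕ-fromℕ; toℕ<n)
  renaming (_≟_ to _≟ᶠ_)
open import Data.Fin.Permutation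
  using (Permutation′; permutation; _⟨$⟩ʳ_; _⟨$⟩ˡ_; inverseˡ; inverseʳ)
open import Data.Vec.Functional using (toList; insertAt)
open import Data.Vec.Functional.Properties using (insertAt-lookup; insertAt-punchIn)
open import Data.List using (List; []; _∷_; take; foldr)
open import Data.Sum using (_⊎_; inj₁; inj₂)
open import Data.Product using (∃; Σ; _×_; _,_; proj₁; proj₂)
open import Data.Empty using (⊥-elim)
open import Relation.Nullary using (¬_; yes; no)
open import Relation.Binary.PropositionalEquality
  using (_≡_; _≢_; refl; sym; trans; cong; cong₂; subst; module ≡-Reasoning)
open import Function.Definitions using (Injective)
open import Algebra.Properties.CommutativeMonoid.Sum ℤP.+-0-commutativeMonoid
  using (sum; ∑-distrib-+; sum-replicate-zero)

open ≡-Reasoning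

sumL : List ℤ → ℤ
sumL = foldr _+_ 0ℤ

sumL-toList : {n : ℕ} (f : Fin n → ℤ) → sumL (toList f) ≡ sum f
sumL-toList {zero}  f = refl
sumL-toList {suc n} f = cong (_+_ (f zero)) (sumL-toList (λ i → f (suc i)))

prefixSum-step : {n : ℕ} (f : Fin n → ℤ) (i : Fin n) →
  sumL (take (suc (toℕ i)) (toList f)) ≡ sumL (take (toℕ i) (toList f)) + f i
prefixSum-step f zero    = trans (ℤP.+-identityʳ (f zero)) (sym (ℤP.+-identityˡ (f zero)))
prefixSum-step f (suc i) = begin
  f zero + sumL (take (suc (toℕ i)) (toList (λ j → f (suc j))))
    ≡⟨ cong (_+_ (f zero)) (prefixSum-step (λ j → f (suc j)) i) ⟩
  f zero + (sumL (take (toℕ i) (toList (λ j → f (suc j)))) + f (suc i))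
    ≡⟨ sym (ℤP.+-assoc (f zero) _ (f (suc i))) ⟩
  f zero + sumL (take (toℕ i) (toList (λ j → f (suc j)))) + f (suc i) ∎

sumL-nonzeros : (xs : List ℤ) → sumL (nonzeros xs) ≡ sumL xs
sumL-nonzeros []       = refl
sumL-nonzeros (x ∷ xs) with x ℤP.≟ 0ℤ
... | yes refl = trans (sumL-nonzeros xs) (sym (ℤP.+-identityˡ (sumL xs)))
... | no  _    = cong (_+_ x) (sumL-nonzeros xs)

sumL-alternating : {xs : List ℤ} → AltSigns xs → sumL xs ≡ 1ℤ
sumL-alternating alt-one = refl
sumL-alternating (alt-step a) rewrite sumL-alternating a = refl

sumL-alternatingNonzeros : (xs : List ℤ) → AltSigns (nonzeros xs) → sumL xs ≡ 1ℤ
sumL-alternatingNonzeros xs a = trans (sym (sumL-nonzeros xs)) (sumL-alternating a)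

Is01 : ℤ → Set
Is01 x = (x ≡ 0ℤ) ⊎ (x ≡ 1ℤ)

data AfterPlusOne : List ℤ → Set where
  done     : AfterPlusOne []
  continue : ∀ {xs} → AltSigns xs → AfterPlusOne (-[1+ 0 ] ∷ xs)

alt-head : ∀ {x xs} → AltSigns (x ∷ xs) → x ≡ 1ℤ × AfterPlusOne xs
alt-head alt-one      = refl , done
alt-head (alt-step a) = refl , continue a

afterPlusOne-head : ∀ {x xs} → AfterPlusOne (x ∷ xs) → x ≡ -[1+ 0 ] × AltSigns xs
afterPlusOne-head (continue a) = refl , a

-- Every prefix sum of a list with alternating nonzeros is 0 or 1; the
-- second statement tracks the state just after a +1 has been read.
mutual
  prefixSum-01 : (xs : List ℤ) → AltSigns (nonzeros xs) → ∀ r → Is01 (sumL (take r xs))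
  prefixSum-01 xs       _ zero    = inj₁ refl
  prefixSum-01 []       () (suc r)
  prefixSum-01 (x ∷ xs) a (suc r) with x ℤP.≟ 0ℤ
  ... | yes refl = subst Is01 (sym (ℤP.+-identityˡ _)) (prefixSum-01 xs a r)
  ... | no  _ with alt-head a
  ...   | refl , rest = prefixSum-01-afterPlusOne xs rest r

  prefixSum-01-afterPlusOne : (xs : List ℤ) → AfterPlusOne (nonzeros xs) →
    ∀ r → Is01 (1ℤ + sumL (take r xs))
  prefixSum-01-afterPlusOne xs       _ zero    = inj₂ refl
  prefixSum-01-afterPlusOne []       _ (suc r) = inj₂ refl
  prefixSum-01-afterPlusOne (x ∷ xs) a (suc r) with x ℤP.≟ 0ℤ
  ... | yes refl = subst (λ s → Is01 (1ℤ + s)) (sym (ℤP.+-identityˡ (sumL (take r xs))))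
                     (prefixSum-01-afterPlusOne xs a r)
  ... | no  _ with afterPlusOne-head a
  ...   | refl , rest = subst Is01 (sym (cancel (sumL (take r xs)))) (prefixSum-01 xs rest r)
    where
    cancel : ∀ s → 1ℤ + (-[1+ 0 ] + s) ≡ s
    cancel s = trans (sym (ℤP.+-assoc 1ℤ -[1+ 0 ] s)) (ℤP.+-identityˡ s)

_∉Im_ : {m n : ℕ} → Fin n → (Fin m → Fin n) → Set
a ∉Im f = ∀ u → f u ≢ a

Distinct : {n : ℕ} → ℕ → (Fin n → Set) → Set
Distinct {n} r P = Σ (Fin r → Fin n) λ e → Injective _≡_ _≡_ e × (∀ s → P (e s))

insertAt-cases : {A : Set} {m : ℕ} (f : Fin m → A) (i : Fin (suc m)) (a : A) (x : Fin (suc m)) →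
  (x ≡ i × insertAt f i a x ≡ a) ⊎ (∃ λ u → x ≡ punchIn i u × insertAt f i a x ≡ f u)
insertAt-cases f i a x with i ≟ᶠ x
... | yes refl = inj₁ (refl , insertAt-lookup f i a)
... | no  i≢x  = inj₂ (punchOut i≢x , sym (punchIn-punchOut i≢x) , (begin
  insertAt f i a x                           ≡⟨ cong (insertAt f i a) (sym (punchIn-punchOut i≢x)) ⟩
  insertAt f i a (punchIn i (punchOut i≢x))  ≡⟨ insertAt-punchIn f i a (punchOut i≢x) ⟩
  f (punchOut i≢x)                           ∎))

insertAt-injective : {m n : ℕ} (f : Fin m → Fin n) (i : Fin (suc m)) (a : Fin n) →
  Injective _≡_ _≡_ f → a ∉Im f → Injective _≡_ _≡_ (insertAt f i a)
insertAt-injective f i a f-inj a∉f {x} {y} eq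
  with insertAt-cases f i a x | insertAt-cases f i a y
... | inj₁ (refl , _)      | inj₁ (refl , _)      = refl
... | inj₁ (_ , fx)        | inj₂ (v , _ , fy)    = ⊥-elim (a∉f v (sym (trans (sym fx) (trans eq fy))))
... | inj₂ (u , _ , fx)    | inj₁ (_ , fy)        = ⊥-elim (a∉f u (trans (sym fx) (trans eq fy)))
... | inj₂ (u , refl , fx) | inj₂ (v , refl , fy) =
  cong (punchIn i) (f-inj (trans (sym fx) (trans eq fy)))

-- If e injects M points into Fin n and g has only K < M points, then some
-- value e s is missed by g (otherwise preimages would inject M into K).
escape : {K M n : ℕ} (g : Fin K → Fin n) (e : Fin M → Fin n) →
  Injective _≡_ _≡_ e → K < M → ∃ λ s → e s ∉Im g
escape {K} {M} g e e-inj K<M with all? (λ s → any? (λ u → g u ≟ᶠ e s))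
... | yes covered = ⊥-elim (<⇒notInjective K<M preimage-injective)
  where
  preimage-injective : Injective _≡_ _≡_ (λ s → proj₁ (covered s))
  preimage-injective {s} {s′} eq =
    e-inj (trans (sym (proj₂ (covered s))) (trans (cong g eq) (proj₂ (covered s′))))
... | no not-covered with ¬∀⟶∃¬ M _ (λ s → any? (λ u → g u ≟ᶠ e s)) not-covered
...   | s , s∉g = s , λ u gu≡es → s∉g (u , gu≡es)

-- An injective endomap of Fin n is surjective: a missed value a would make
-- insertAt f zero a an injection of Fin (suc n) into Fin n.
injective⇒surjective : {n : ℕ} (f : Fin n → Fin n) → Injective _≡_ _≡_ f →
  ∀ a → ∃ λ i → f i ≡ a
injective⇒surjective {n} f f-inj a with any? (λ i → f i ≟ᶠ a)
... | yes hit = hit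
... | no  miss = ⊥-elim (<⇒notInjective (ℕP.n<1+n n)
                  (insertAt-injective f zero a f-inj (λ u fu≡a → miss (u , fu≡a))))

injection⇒permutation : {n : ℕ} (f : Fin n → Fin n) → Injective _≡_ _≡_ f →
  Σ (Permutation′ n) λ σ → ∀ i → σ ⟨$⟩ʳ i ≡ f i
injection⇒permutation {n} f f-inj =
  permutation f f⁻¹ (λ a → proj₂ (injective⇒surjective f f-inj a))
                    (λ i → f-inj (proj₂ (injective⇒surjective f f-inj (f i)))) ,
  λ i → refl
  where
  f⁻¹ : Fin n → Fin n
  f⁻¹ a = proj₁ (injective⇒surjective f f-inj a)

-- Punching in at the last position does not shift: the first K sets of a
-- family indexed by Fin (suc K) are those at inject₁ t.
punchIn-fromℕ : {n : ℕ} (u : Fin n) → punchIn (fromℕ n) u ≡ inject₁ u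
punchIn-fromℕ zero    = refl
punchIn-fromℕ (suc u) = cong suc (punchIn-fromℕ u)

-- The
-- last set has K + 1 elements, so it has one avoiding the K earlier choices.
greedySDR : {n : ℕ} (K : ℕ) (Q : Fin K → Fin n → Set) →
  (∀ t → Distinct (suc (toℕ t)) (Q t)) →
  Σ (Fin K → Fin n) λ g → Injective _≡_ _≡_ g × (∀ t → Q t (g t))
greedySDR zero    Q large = (λ ()) , (λ {x} → λ { }) , (λ ())
greedySDR (suc K) Q large
  with greedySDR K (λ t → Q (punchIn (fromℕ K) t)) earlier-large
     | subst (λ r → Distinct (suc r) (Q (fromℕ K))) (toℕ-fromℕ K) (large (fromℕ K))
  where
  earlier-large : ∀ t → Distinct (suc (toℕ t)) (Q (punchIn (fromℕ K) t))
  earlier-large t = subst (λ r → Distinct (suc r) (Q (punchIn (fromℕ K) t)))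
    (trans (cong toℕ (punchIn-fromℕ t)) (toℕ-inject₁ t)) (large (punchIn (fromℕ K) t))
... | g , g-inj , g-ok | e , e-inj , e-ok with escape g e e-inj (ℕP.n<1+n K)
...   | s , es∉g = insertAt g (fromℕ K) (e s) , insertAt-injective g (fromℕ K) (e s) g-inj es∉g , ok
  where
  ok : ∀ t → Q t (insertAt g (fromℕ K) (e s) t)
  ok t with insertAt-cases g (fromℕ K) (e s) t
  ... | inj₁ (refl , value)     = subst (Q t) (sym value) (e-ok s)
  ... | inj₂ (u , refl , value) = subst (Q t) (sym value) (g-ok u)

record Support {n : ℕ} (v : Fin n → ℤ) (m : ℕ) : Set where
  field
    position : Fin m → Fin n
    injective : Injective _≡_ _≡_ position
    sound : ∀ s → v (position s) ≡ 1ℤ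
    complete : ∀ j → v j ≡ 1ℤ → ∃ λ s → position s ≡ j

  distinct : Distinct m (λ j → v j ≡ 1ℤ)
  distinct = position , injective , sound

support : {n : ℕ} (v : Fin n → ℤ) → (∀ j → Is01 (v j)) → ∃ λ m → sum v ≡ + m × Support v m
support {zero} v _ = 0 , refl , record
  { position = λ () ; injective = λ {x} → λ { } ; sound = λ () ; complete = λ () }
support {suc n} v v01 with support (λ j → v (suc j)) (λ j → v01 (suc j)) | v01 zero
... | m , sum≡m , S | inj₁ v0≡0 = m , sum≡ , record
  { position = λ s → suc (position s)
  ; injective = λ eq → injective (suc-injective eq)
  ; sound = sound
  ; complete = λ { zero v0≡1 → ⊥-elim (0≢1 (trans (sym v0≡0) v0≡1))
                 ; (suc j) vj≡1 → let (s , eq) = complete j vj≡1 in s , cong suc eq } }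
  where
  open Support S
  0≢1 : 0ℤ ≢ 1ℤ
  0≢1 ()
  sum≡ : v zero + sum (λ j → v (suc j)) ≡ + m
  sum≡ = trans (cong (_+ sum (λ j → v (suc j))) v0≡0) (trans (ℤP.+-identityˡ _) sum≡m)
... | m , sum≡m , S | inj₂ v0≡1 = suc m , cong₂ _+_ v0≡1 sum≡m , record
  { position = insertAt shifted zero zero
  ; injective = insertAt-injective shifted zero zero (λ eq → injective (suc-injective eq)) (λ _ ())
  ; sound = λ { zero → v0≡1 ; (suc s) → sound s }
  ; complete = λ { zero _ → zero , refl
                 ; (suc j) vj≡1 → let (s , eq) = complete j vj≡1 in suc s , cong suc eq } }
  where
  open Support S
  shifted : Fin m → Fin (suc n)
  shifted s = suc (position s)

support-ofSum : {n r : ℕ} (v : Fin n → ℤ) → (∀ j → Is01 (v j)) → sum v ≡ + r → Support v r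
support-ofSum v v01 sum≡r with support v v01
... | m , sum≡m , S = subst (Support v) (ℤP.+-injective (trans (sym sum≡m) sum≡r)) S

columnPrefixSums-total : {m n : ℕ} (M : Fin m → Fin n → ℤ) → (∀ i → sum (M i) ≡ 1ℤ) →
  ∀ r → r ≤ m → sum (λ j → sumL (take r (toList (λ i → M i j)))) ≡ + r
columnPrefixSums-total {n = n} M rows1 zero _ = sum-replicate-zero n
columnPrefixSums-total {suc m} M rows1 (suc r) (s≤s r≤m) = begin
  sum (λ j → M zero j + sumL (take r (toList (λ i → M (suc i) j))))
    ≡⟨ ∑-distrib-+ (M zero) (λ j → sumL (take r (toList (λ i → M (suc i) j)))) ⟩
  sum (M zero) + sum (λ j → sumL (take r (toList (λ i → M (suc i) j))))
    ≡⟨ cong₂ _+_ (rows1 zero) (columnPrefixSums-total (λ i → M (suc i)) (λ i → rows1 (suc i)) r r≤m) ⟩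
  + suc r ∎

permMatrix-cases : {n : ℕ} (σ : Permutation′ n) (i j : Fin n) →
  (j ≡ σ ⟨$⟩ʳ i × permMatrix σ i j ≡ 1ℤ) ⊎ (j ≢ σ ⟨$⟩ʳ i × permMatrix σ i j ≡ 0ℤ)
permMatrix-cases σ i j with j ≟ᶠ (σ ⟨$⟩ʳ i)
... | yes j≡σi = inj₁ (j≡σi , refl)
... | no  j≢σi = inj₂ (j≢σi , refl)

nonzeros-unit : {n : ℕ} (f : Fin n → ℤ) (a : Fin n) → f a ≡ 1ℤ → (∀ j → j ≢ a → f j ≡ 0ℤ) →
  nonzeros (toList f) ≡ 1ℤ ∷ []
nonzeros-unit f zero fa≡1 rest with f zero | fa≡1
... | .1ℤ | refl = cong (1ℤ ∷_) (nonzeros-zero (λ j → f (suc j)) (λ j → rest (suc j) (λ ())))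
  where
  nonzeros-zero : {n : ℕ} (g : Fin n → ℤ) → (∀ j → g j ≡ 0ℤ) → nonzeros (toList g) ≡ []
  nonzeros-zero {zero}  g _     = refl
  nonzeros-zero {suc n} g g≡0 with g zero | g≡0 zero
  ... | .0ℤ | refl = nonzeros-zero (λ j → g (suc j)) (λ j → g≡0 (suc j))
nonzeros-unit f (suc a) fa≡1 rest with f zero | rest zero (λ ())
... | .0ℤ | refl = nonzeros-unit (λ j → f (suc j)) a fa≡1 (λ j j≢a → rest (suc j) (λ eq → j≢a (suc-injective eq)))

-- A permutation matrix is an alternating sign matrix: every row and every
-- column is a standard unit vector.
permMatrix-isASM : {n : ℕ} (σ : Permutation′ n) → IsASM (permMatrix σ)
permMatrix-isASM σ = record { entries = entries ; rows = rows ; cols = cols }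
  where
  P = permMatrix σ
  entries : Is01m1Matrix P
  entries i j with permMatrix-cases σ i j
  ... | inj₁ (_ , Pij≡1) = inj₂ (inj₁ Pij≡1)
  ... | inj₂ (_ , Pij≡0) = inj₁ Pij≡0
  at : ∀ i j → j ≡ σ ⟨$⟩ʳ i → P i j ≡ 1ℤ
  at i j j≡σi with permMatrix-cases σ i j
  ... | inj₁ (_ , Pij≡1)    = Pij≡1
  ... | inj₂ (j≢σi , _)     = ⊥-elim (j≢σi j≡σi)
  off : ∀ i j → j ≢ σ ⟨$⟩ʳ i → P i j ≡ 0ℤ
  off i j j≢σi with permMatrix-cases σ i j
  ... | inj₁ (j≡σi , _)     = ⊥-elim (j≢σi j≡σi)
  ... | inj₂ (_ , Pij≡0)    = Pij≡0
  rows : ∀ i → AltSigns (nonzeros (row P i))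
  rows i = subst AltSigns (sym (nonzeros-unit (P i) (σ ⟨$⟩ʳ i) (at i _ refl) (off i))) alt-one
  cols : ∀ j → AltSigns (nonzeros (col P j))
  cols j = subst AltSigns
    (sym (nonzeros-unit (λ i → P i j) (σ ⟨$⟩ˡ j) (at _ j (sym (inverseʳ σ)))
           (λ i i≢σ⁻¹j → off i j (λ j≡σi → i≢σ⁻¹j (trans (sym (inverseˡ σ)) (cong (σ ⟨$⟩ˡ_) (sym j≡σi)))))))
    alt-one

permMatrix-sum-01m1 : {n : ℕ} (A : Matrix n) (σ : Permutation′ n) → Is01m1Matrix A →
  (∀ i → A i (σ ⟨$⟩ʳ i) ≢ 1ℤ) → Is01m1Matrix (A ⊕ permMatrix σ)
permMatrix-sum-01m1 A σ A01m1 avoids i j with permMatrix-cases σ i j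
... | inj₂ (_ , Pij≡0) rewrite Pij≡0 = subst Is01m1 (sym (ℤP.+-identityʳ (A i j))) (A01m1 i j)
... | inj₁ (refl , Pij≡1) rewrite Pij≡1 = add-one (A01m1 i (σ ⟨$⟩ʳ i)) (avoids i)
  where
  add-one : ∀ {x} → Is01m1 x → x ≢ 1ℤ → Is01m1 (x + 1ℤ)
  add-one (inj₁ refl)        _   = inj₂ (inj₁ refl)
  add-one (inj₂ (inj₁ refl)) x≢1 = ⊥-elim (x≢1 refl)
  add-one (inj₂ (inj₂ refl)) _   = inj₁ refl

module AvoidingPermutation (k : ℕ) (A : Matrix (suc (suc k))) (asm : IsASM A) where
  open IsASM asm

  N : ℕ
  N = suc (suc k)

  colPrefix : ℕ → Fin N → ℤ
  colPrefix r j = sumL (take r (col A j))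

  colPrefix-01 : ∀ r j → Is01 (colPrefix r j)
  colPrefix-01 r j = prefixSum-01 (col A j) (cols j) r

  openColumns : ∀ r → r ≤ N → Support (colPrefix r) r
  openColumns r r≤N = support-ofSum (colPrefix r) (colPrefix-01 r)
    (columnPrefixSums-total A rowSum r r≤N)
    where
    rowSum : ∀ i → sum (A i) ≡ 1ℤ
    rowSum i = trans (sym (sumL-toList (A i))) (sumL-alternatingNonzeros (row A i) (rows i))

  -- Distinct columns g t, open after the first t + 1 rows, for the rows t + 1.
  IsOpenAfter : Fin (suc k) → Fin N → Set
  IsOpenAfter t j = colPrefix (suc (toℕ t)) j ≡ 1ℤ

  choice : Σ (Fin (suc k) → Fin N) λ g → Injective _≡_ _≡_ g × (∀ t → IsOpenAfter t (g t))
  choice = greedySDR (suc k) IsOpenAfter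
    (λ t → Support.distinct (openColumns (suc (toℕ t)) (s≤s (ℕP.<⇒≤ (toℕ<n t)))))

  g : Fin (suc k) → Fin N
  g = proj₁ choice

  g-open : ∀ t → IsOpenAfter t (g t)
  g-open = proj₂ (proj₂ choice)

  remaining : ∃ λ c → c ∉Im g
  remaining = escape g (λ j → j) (λ eq → eq) (ℕP.n<1+n (suc k))

  σ : Fin N → Fin N
  σ = insertAt g zero (proj₁ remaining)

  σ-injective : Injective _≡_ _≡_ σ
  σ-injective = insertAt-injective g zero (proj₁ remaining) (proj₁ (proj₂ choice)) (proj₂ remaining)

  avoids : ∀ i → A i (σ i) ≢ 1ℤ
  avoids zero A0c≡1 = proj₂ remaining zero (begin
    g zero                         ≡⟨ sym (proj₂ (complete (g zero) (g-open zero))) ⟩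
    position (proj₁ (complete (g zero) (g-open zero)))
                                   ≡⟨ cong position (Fin1-unique _ _) ⟩
    position (proj₁ (complete c c-open)) ≡⟨ proj₂ (complete c c-open) ⟩
    c                              ∎)
    where
    open Support (openColumns 1 (s≤s z≤n))
    c = proj₁ remaining
    c-open : colPrefix 1 c ≡ 1ℤ
    c-open = trans (ℤP.+-identityʳ (A zero c)) A0c≡1
    Fin1-unique : (s s′ : Fin 1) → s ≡ s′
    Fin1-unique zero zero = refl
  avoids (suc t) A1+t≡1 = two∉01 (subst Is01 twoRows (colPrefix-01 (suc (suc (toℕ t))) (g t)))
    where
    twoRows : colPrefix (suc (suc (toℕ t))) (g t) ≡ + 2
    twoRows = trans (prefixSum-step (λ i → A i (g t)) (suc t)) (cong₂ _+_ (g-open t) A1+t≡1)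
    two∉01 : ¬ Is01 (+ 2)
    two∉01 (inj₁ ())
    two∉01 (inj₂ ())

avoidingPermutation : (k : ℕ) (A : Matrix (suc (suc k))) → IsASM A →
  Σ (Permutation′ (suc (suc k))) λ σ → ∀ i → A i (σ ⟨$⟩ʳ i) ≢ 1ℤ
avoidingPermutation k A asm =
  proj₁ π , λ i → subst (λ j → A i j ≢ 1ℤ) (sym (proj₂ π i)) (avoids i)
  where
  open AvoidingPermutation k A asm
  π : Σ (Permutation′ N) λ π → ∀ i → π ⟨$⟩ʳ i ≡ σ i
  π = injection⇒permutation σ σ-injective

theorem4p14 : (n : ℕ) → n ≥ 2 → (A : Matrix n) → IsASM A →
    ∃ λ (P : Matrix n) → IsPermutationMatrix P × Is01m1Matrix (A ⊕ P) × IsASMMate A P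
theorem4p14 (suc zero) (s≤s ()) A asm
theorem4p14 (suc (suc k)) _ A asm =
  permMatrix σ , (σ , λ _ _ → refl) , sum-01m1 , permMatrix-isASM σ , sum-01m1
  where
  avoiding : Σ (Permutation′ (suc (suc k))) λ σ → ∀ i → A i (σ ⟨$⟩ʳ i) ≢ 1ℤ
  avoiding = avoidingPermutation k A asm
  σ : Permutation′ (suc (suc k))
  σ = proj₁ avoiding
  sum-01m1 : Is01m1Matrix (A ⊕ permMatrix σ)
  sum-01m1 = permMatrix-sum-01m1 A σ (IsASM.entries asm) (proj₂ avoiding)
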